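{- Let $R(\mathbf{x},\mathbf{x}')$ be a balanced difference bounds constraint over $N$ variables, let $n\ge1$, and let $\xi$ be a path in $\mathcal{G}_R^n$ from $x_i^{(p)}$ to $x_j^{(q)}$ with $1\le i,j\le N$ and $p,q\in\{0,n\}$. If no subpath of $\xi$ is a long corner, then, with $w(\xi)$ the weight of $\xi$: (1) if $p=0,q=n$: $\phi(\ell,\mathbf{x},\mathbf{x}')[n/\ell]\Rightarrow x_i-x_j'\le w(\xi)$; (2) if $p=n,q=0$: $\phi(\ell,\mathbf{x},\mathbf{x}')[n/\ell]\Rightarrow x_i'-x_j\le w(\xi)$; (3) if $p=q=0$: $\phi(\ell,\mathbf{x},\mathbf{x}')[n/\ell]\Rightarrow x_i-x_j\le w(\xi)$; (4) if $p=q=n$: $\phi(\ell,\mathbf{x},\mathbf{x}')[n/\ell]\Rightarrow x_i'-x_j'\le w(\xi)$.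
   Context: Variables range over $\mathbb{Z}$; $\mathbf{x}=\{x_1,\dots,x_N\}$, $\mathbf{x}'$ its primed copy. A difference bounds constraint is a finite conjunction of atoms $u-v\le c$, $c\in\mathbb{Z}$; its constraint graph has an edge $u\xrightarrow{c}v$ per atom. $R$ is balanced if $x_i-x_j\le c$ is an atom of $R$ iff $x_i'-x_j'\le c$ is. $R^n$ is the $n$-fold composition. $S_{fw}(\mathbf{x}):=\exists\mathbf{x}'.R^{N^2}(\mathbf{x},\mathbf{x}')$, $S_{bw}(\mathbf{x}'):=\exists\mathbf{x}.R^{N^2}(\mathbf{x},\mathbf{x}')$, $R_s:=R\wedge S_{fw}(\mathbf{x})\wedge S_{bw}(\mathbf{x}')$; $R_{fw}$ is the conjunction of all atoms $x_a-x_b'\le c$ ($c\in\mathbb{Z}$) implied by $R_s$, $R_{bw}$ the conjunction of all atoms $x_a'-x_b\le c$ implied by $R_s$. A closed form of a relation $T$ is a formula $\widehat{T}(\ell,\mathbf{x},\mathbf{x}')$ such that for every $m\ge1$, $\widehat{T}[m/\ell]$ defines $T^m$. $\widehat{R}_{fw},\widehat{R}_{bw}$ are closed forms of $R_{fw},R_{bw}$, and $\phi(\ell,\mathbf{x},\mathbf{x}'):=\widehat{R}_{fw}(\ell,\mathbf{x},\mathbf{x}')\wedge\widehat{R}_{bw}(\ell,\mathbf{x},\mathbf{x}')\wedge S_{fw}(\mathbf{x})\wedge S_{bw}(\mathbf{x}')$. With fresh copies $x_a^{(p)}$ (position $p$), $\mathcal{G}_R^n$ is the union over $p=0,\dots,n-1$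 of the constraint graphs of $R(\mathbf{x}^{(p)},\mathbf{x}^{(p+1)})$. A corner is a path with at least one edge whose endpoints have the same position $k_0$ and whose positions form $\{k_0,\dots,k_0+d\}$ or $\{k_0-d,\dots,k_0\}$; $d$ is its extent; it is long if $d>N^2$. -}

module Defs where

open import Data.Nat as ℕ using (ℕ; zero; suc; _<_)
open import Data.Integer as ℤ using (ℤ; _-_)
open import Data.Fin using (Fin)
open import Data.Sum using (_⊎_; inj₁; inj₂)
open import Data.Product using (Σ; ∃; _×_; _,_; proj₂)
open import Data.List using (List; []; _∷_; map; length)
open import Data.List.Relation.Unary.All using (All)
open import Data.List.Membership.Propositional using (_∈_)
open import Function.Bundles using (_⇔_)
open import Relation.Binary.PropositionalEquality using (_≡_)
open import Relation.Nullary using (¬_)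

-- inj₁ a = x_a (unprimed), inj₂ a = x_a' (primed)
Var : ℕ → Set
Var N = Fin N ⊎ Fin N

record Atom (N : ℕ) : Set where
  constructor atom
  field
    lhs : Var N
    rhs : Var N
    bound : ℤ

DBC : ℕ → Set
DBC N = List (Atom N)

Val : ℕ → Set
Val N = Fin N → ℤ

Rel : ℕ → Set₁
Rel N = Val N → Val N → Set

ev : ∀ {N} → Val N → Val N → Var N → ℤ
ev x x' (inj₁ a) = x a
ev x x' (inj₂ a) = x' a

⟦_⟧ : ∀ {N} → DBC N → Rel N
⟦ R ⟧ x x' = All (λ at → (ev x x' (Atom.lhs at) - ev x x' (Atom.rhs at)) ℤ.≤ Atom.bound at) R

Balanced : ∀ {N} → DBC N → Set
Balanced {N} R = ∀ (i j : Fin N) (c : ℤ) →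
  (atom (inj₁ i) (inj₁ j) c ∈ R) ⇔ (atom (inj₂ i) (inj₂ j) c ∈ R)

Pow : ∀ {N} → Rel N → ℕ → Rel N
Pow T zero x x' = ∀ a → x a ≡ x' a
Pow {N} T (suc m) x x'' = Σ (Val N) λ y → T x y × Pow T m y x''

Sfw : ∀ {N} → DBC N → Val N → Set
Sfw {N} R x = Σ (Val N) λ x' → Pow ⟦ R ⟧ (N ℕ.* N) x x'

Sbw : ∀ {N} → DBC N → Val N → Set
Sbw {N} R x' = Σ (Val N) λ x → Pow ⟦ R ⟧ (N ℕ.* N) x x'

Rs : ∀ {N} → DBC N → Rel N
Rs R x x' = ⟦ R ⟧ x x' × Sfw R x × Sbw R x'

-- conjunction of all atoms x_a - x_b' ≤ c implied by R_s
Rfw : ∀ {N} → DBC N → Rel N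
Rfw {N} R x x' = ∀ (a b : Fin N) (c : ℤ) →
  (∀ y y' → Rs R y y' → (y a - y' b) ℤ.≤ c) → (x a - x' b) ℤ.≤ c

-- conjunction of all atoms x_a' - x_b ≤ c implied by R_s
Rbw : ∀ {N} → DBC N → Rel N
Rbw {N} R x x' = ∀ (a b : Fin N) (c : ℤ) →
  (∀ y y' → Rs R y y' → (y' a - y b) ℤ.≤ c) → (x' a - x b) ℤ.≤ c

-- closed form: a formula with free ℓ, x, x' such that T̂[m/ℓ] defines T^m for m ≥ 1
IsClosedForm : ∀ {N} → Rel N → (ℕ → Rel N) → Set
IsClosedForm T T̂ = ∀ (m : ℕ) → 1 ℕ.≤ m → ∀ x x' → T̂ m x x' ⇔ Pow T m x x'

φ : ∀ {N} → DBC N → (ℕ → Rel N) → (ℕ → Rel N) → ℕ → Rel N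
φ R R̂fw R̂bw ℓ x x' = R̂fw ℓ x x' × R̂bw ℓ x x' × Sfw R x × Sbw R x'

-- vertex x_a^(p)
Vtx : ℕ → Set
Vtx N = Fin N × ℕ

pos : ∀ {N} → Vtx N → ℕ
pos = proj₂

-- copy of a variable of R(x^(p), x^(p+1))
place : ∀ {N} → ℕ → Var N → Vtx N
place p (inj₁ a) = a , p
place p (inj₂ a) = a , suc p

data Edge {N : ℕ} (R : DBC N) (n : ℕ) : Vtx N → Vtx N → ℤ → Set where
  edge : ∀ {u v c p} → p < n → atom u v c ∈ R → Edge R n (place p u) (place p v) c

data Path {N : ℕ} (R : DBC N) (n : ℕ) : Vtx N → Vtx N → Set where
  [] : ∀ {s} → Path R n s s
  _∷_ : ∀ {s t u c} → Edge R n s t c → Path R n t u → Path R n s u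

module _ {N : ℕ} {R : DBC N} {n : ℕ} where

  weight : ∀ {s t} → Path R n s t → ℤ
  weight [] = ℤ.0ℤ
  weight (_∷_ {c = c} e ξ) = c ℤ.+ weight ξ

  numEdges : ∀ {s t} → Path R n s t → ℕ
  numEdges [] = 0
  numEdges (e ∷ ξ) = suc (numEdges ξ)

  _++ₚ_ : ∀ {s t u} → Path R n s t → Path R n t u → Path R n s u
  [] ++ₚ η = η
  (e ∷ ξ) ++ₚ η = e ∷ (ξ ++ₚ η)

  vertices : ∀ {s t} → Path R n s t → List (Vtx N)
  vertices {s} [] = s ∷ []
  vertices {s} (e ∷ ξ) = s ∷ vertices ξ

  positions : ∀ {s t} → Path R n s t → List ℕ
  positions ξ = map pos (vertices ξ)

  IsSubpath : ∀ {s' t' s t} → Path R n s' t' → Path R n s t → Set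
  IsSubpath {s'} {t'} {s} {t} ζ ξ =
    Σ (Path R n s s') λ α → Σ (Path R n t' t) λ β → ξ ≡ α ++ₚ (ζ ++ₚ β)

  IsCorner : ∀ {s t} → Path R n s t → ℕ → Set
  IsCorner {s} {t} ζ d =
    1 ℕ.≤ numEdges ζ × pos s ≡ pos t ×
    ( (∀ k → (k ∈ positions ζ) ⇔ (pos s ℕ.≤ k × k ℕ.≤ pos s ℕ.+ d))
    ⊎ (d ℕ.≤ pos s × ∀ k → (k ∈ positions ζ) ⇔ (pos s ℕ.∸ d ℕ.≤ k × k ℕ.≤ pos s)))

  IsLongCorner : ∀ {s t} → Path R n s t → Set
  IsLongCorner ζ = Σ ℕ λ d → IsCorner ζ d × N ℕ.* N < d

  NoLongCornerSubpath : ∀ {s t} → Path R n s t → Set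
  NoLongCornerSubpath ξ = ∀ {s' t'} (ζ : Path R n s' t') → IsSubpath ζ ξ → ¬ IsLongCorner ζ

module Submission where

-- Proof idea.  Write K = N², y_0, …, y_n for the intermediate valuations of a
-- witness of R_fw^n(x, x') and z_0, …, z_n for those of R_bw^n(x, x').
--
-- * A path staying inside a window of levels [lo, hi] (lo < hi) is bounded by
--   any R-chain V_lo, …, V_hi: every edge is an atom of R between two
--   consecutive levels of the window (balance moves horizontal edges on the
--   border levels inside), and the atom bounds telescope along the path.
-- * A path that starts and ends at level L and never goes below L (above L)
--   is a corner of extent (highest level − L), resp. (L − lowest level), so
--   without long corners it stays inside [L, L + K] (inside [L − K, L]).  The
--   witnesses of S_fw(x), S_bw(x') are R-chains of length K, which therefore
--   bound such excursions at levels 0 and n: this gives cases (3) and (4).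
-- * For case (1), a path from level 0 to level m + 1 never rising above
--   m + 1 is cut where it first reaches m + 1, necessarily by an up-edge from
--   level m: the prefix is handled by induction on m, and the up-edge followed
--   by the remaining excursion below m + 1 is an atom implied by R_s, hence by
--   R_fw, hence it bounds y_m − y_{m+1}.  Case (2) is symmetric, with
--   down-edges and R_bw.

open import Defs
open import Data.Nat as ℕ using (ℕ; zero; suc; _≤_; _<_; _∸_; _+_; z≤n; s≤s; _≟_; _<?_; _≤?_)
import Data.Nat.Properties as ℕₚ
open import Data.Integer as ℤ using (ℤ; _-_)
import Data.Integer.Properties as ℤₚ
open import Data.Fin using (Fin)
open import Data.Sum using (inj₁; inj₂; [_,_]′)
open import Data.Product using (_×_; _,_; proj₁; proj₂)
open import Data.List using ([]; _∷_)
open import Data.List.Extrema.Nat using (min; max; argmin-sel; argmax-sel; min≤xs; xs≤max)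
open import Data.List.Relation.Unary.All as All using (All; []; _∷_)
open import Data.List.Relation.Unary.Any using (here; there)
open import Data.List.Membership.Propositional using (_∈_)
open import Data.Empty using (⊥-elim)
open import Function using (id)
open import Function.Bundles using (mk⇔; Equivalence)
open import Relation.Binary.PropositionalEquality using (_≡_; refl; sym; trans; cong; subst; subst₂)
open import Relation.Nullary using (¬_; yes; no)

diff-trans : ∀ {a b c x y : ℤ} → a - b ℤ.≤ x → b - c ℤ.≤ y → a - c ℤ.≤ x ℤ.+ y
diff-trans {a} {b} {c} h₁ h₂ =
  subst (ℤ._≤ _) (ℤₚ.+-minus-telescope a b c) (ℤₚ.+-mono-≤ h₁ h₂)

diff-refl : ∀ (a : ℤ) → a - a ℤ.≤ ℤ.0ℤ
diff-refl a = ℤₚ.≤-reflexive (ℤₚ.+-inverseʳ a)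

∸-decreasing : ∀ {L m} → 0 < L → 0 < m → L ∸ m < L
∸-decreasing {suc L} {suc m} _ _ = s≤s (ℕₚ.m∸n≤m L m)

level-below : ∀ {k m n} → suc k + m ≡ n → m < n
level-below {k} {m} eq = subst (m <_) eq (s≤s (ℕₚ.m≤n+m m k))

InWindow : ℕ → ℕ → ℕ → Set
InWindow lo hi k = lo ≤ k × k ≤ hi

module _ {N : ℕ} where

  IsChain : Rel N → (ℕ → Val N) → ℕ → ℕ → Set
  IsChain T V lo hi = ∀ k → lo ≤ k → k < hi → T (V k) (V (suc k))

  chain-translate : ∀ {T V lo hi lo' hi'} s → lo ≤ lo' + s → hi' + s ≤ hi →
    IsChain T V lo hi → IsChain T (λ k → V (k + s)) lo' hi'
  chain-translate s lo≤ ≤hi H k lo'≤k k<hi' =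
    H (k + s) (ℕₚ.≤-trans lo≤ (ℕₚ.+-monoˡ-≤ s lo'≤k)) (ℕₚ.≤-trans (ℕₚ.+-monoˡ-≤ s k<hi') ≤hi)

  chain-offset : ∀ {T V m} L → IsChain T V 0 m → IsChain T (λ k → V (k ∸ L)) L (L + m)
  chain-offset {T} {V} {m} L H k L≤k k<L+m =
    subst (λ j → T (V (k ∸ L)) (V j)) (sym (ℕₚ.+-∸-assoc 1 L≤k))
      (H (k ∸ L) z≤n (subst (k ∸ L <_) (ℕₚ.m+n∸m≡n L m) (ℕₚ.∸-monoˡ-< k<L+m L≤k)))

  module _ {T : Rel N} where

    trace : ∀ m {x x'} → Pow T m x x' → ℕ → Val N
    trace zero    {x} _           _       = x
    trace (suc m) {x} _           zero    = x
    trace (suc m)     (_ , _ , w) (suc k) = trace m w k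

    trace-start : ∀ m {x x'} (w : Pow T m x x') → trace m w 0 ≡ x
    trace-start zero    _ = refl
    trace-start (suc m) _ = refl

    trace-end : ∀ m {x x'} (w : Pow T m x x') a → trace m w m a ≡ x' a
    trace-end zero    w           a = w a
    trace-end (suc m) (_ , _ , w) a = trace-end m w a

    trace-chain : ∀ m {x x'} (w : Pow T m x x') → IsChain T (trace m w) 0 m
    trace-chain (suc m) (_ , t , w) zero    _ _         = subst (T _) (sym (trace-start m w)) t
    trace-chain (suc m) (_ , _ , w) (suc k) _ (s≤s k<m) = trace-chain m w k z≤n k<m

module _ {N : ℕ} {R : DBC N} {n : ℕ} where

  ++-assoc : ∀ {s t u v} (A : Path R n s t) (B : Path R n t u) (C : Path R n u v) →
    (A ++ₚ B) ++ₚ C ≡ A ++ₚ (B ++ₚ C)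
  ++-assoc []      B C = refl
  ++-assoc (e ∷ A) B C = cong (e ∷_) (++-assoc A B C)

  ++-identityʳ : ∀ {s t} (A : Path R n s t) → A ++ₚ [] ≡ A
  ++-identityʳ []      = refl
  ++-identityʳ (e ∷ A) = cong (e ∷_) (++-identityʳ A)

  weight-++ : ∀ {s t u} (A : Path R n s t) (B : Path R n t u) →
    weight (A ++ₚ B) ≡ weight A ℤ.+ weight B
  weight-++ []                B = sym (ℤₚ.+-identityˡ (weight B))
  weight-++ (_∷_ {c = c} e A) B =
    trans (cong (λ w → c ℤ.+ w) (weight-++ A B)) (sym (ℤₚ.+-assoc c (weight A) (weight B)))

  noLong-prefix : ∀ {s t u} (A : Path R n s t) (B : Path R n t u) →
    NoLongCornerSubpath (A ++ₚ B) → NoLongCornerSubpath A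
  noLong-prefix A B nl ζ (α , β , eq) = nl ζ (α , β ++ₚ B , reassoc)
    where
    reassoc : A ++ₚ B ≡ α ++ₚ (ζ ++ₚ (β ++ₚ B))
    reassoc = trans (cong (_++ₚ B) eq)
                 (trans (++-assoc α (ζ ++ₚ β) B) (cong (α ++ₚ_) (++-assoc ζ β B)))

  noLong-suffix : ∀ {s t u} (A : Path R n s t) (B : Path R n t u) →
    NoLongCornerSubpath (A ++ₚ B) → NoLongCornerSubpath B
  noLong-suffix A B nl ζ (α , β , eq) =
    nl ζ (A ++ₚ α , β , trans (cong (A ++ₚ_) eq) (sym (++-assoc A α (ζ ++ₚ β))))

  noLong-whole : ∀ {s t} (ξ : Path R n s t) → NoLongCornerSubpath ξ → ¬ IsLongCorner ξ
  noLong-whole ξ nl = nl ξ ([] , [] , sym (++-identityʳ ξ))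

  all-suffix : ∀ {P : ℕ → Set} {s t u} (A : Path R n s t) (B : Path R n t u) →
    All P (positions (A ++ₚ B)) → All P (positions B)
  all-suffix []      B h       = h
  all-suffix (e ∷ A) B (_ ∷ h) = all-suffix A B h

  all-head : ∀ {P : ℕ → Set} {s t} (A : Path R n s t) → All P (positions A) → P (pos s)
  all-head []      (p ∷ _) = p
  all-head (_ ∷ _) (p ∷ _) = p

  head∈ : ∀ {s t} (A : Path R n s t) → pos s ∈ positions A
  head∈ []      = here refl
  head∈ (_ ∷ _) = here refl

  edge-step : ∀ {s t c} → Edge R n s t c → pos s ≤ suc (pos t) × pos t ≤ suc (pos s)
  edge-step (edge {u = inj₁ _} {v = inj₁ _} {p = p} _ _) = ℕₚ.n≤1+n p , ℕₚ.n≤1+n p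
  edge-step (edge {u = inj₁ _} {v = inj₂ _} {p = p} _ _) = ℕₚ.m≤n⇒m≤1+n (ℕₚ.n≤1+n p) , ℕₚ.≤-refl
  edge-step (edge {u = inj₂ _} {v = inj₁ _} {p = p} _ _) = ℕₚ.≤-refl , ℕₚ.m≤n⇒m≤1+n (ℕₚ.n≤1+n p)
  edge-step (edge {u = inj₂ _} {v = inj₂ _} {p = p} _ _) = ℕₚ.n≤1+n (suc p) , ℕₚ.n≤1+n (suc p)

  edge-target≤n : ∀ {s t c} → Edge R n s t c → pos t ≤ n
  edge-target≤n (edge {v = inj₁ _} p<n _) = ℕₚ.<⇒≤ p<n
  edge-target≤n (edge {v = inj₂ _} p<n _) = p<n

  positions≤n : ∀ {s t} (A : Path R n s t) → pos s ≤ n → All (_≤ n) (positions A)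
  positions≤n []      s≤n = s≤n ∷ []
  positions≤n (e ∷ A) s≤n = s≤n ∷ positions≤n A (edge-target≤n e)

  ivt-down : ∀ {s t m k} (A : Path R n s t) → m ∈ positions A → m ≤ k → k ≤ pos s → k ∈ positions A
  ivt-down []      (here refl) m≤k k≤s = here (ℕₚ.≤-antisym k≤s m≤k)
  ivt-down {s} {k = k} (e ∷ A) m∈ m≤k k≤s with k ≟ pos s
  ... | yes refl = here refl
  ... | no k≢s with m∈
  ...   | here refl  = ⊥-elim (k≢s (ℕₚ.≤-antisym k≤s m≤k))
  ...   | there m∈A  =
    there (ivt-down A m∈A m≤k (ℕₚ.≤-pred (ℕₚ.≤-trans (ℕₚ.≤∧≢⇒< k≤s k≢s) (proj₁ (edge-step e)))))

  ivt-up : ∀ {s t m k} (A : Path R n s t) → m ∈ positions A → pos s ≤ k → k ≤ m → k ∈ positions A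
  ivt-up []      (here refl) s≤k k≤m = here (ℕₚ.≤-antisym k≤m s≤k)
  ivt-up {s} {k = k} (e ∷ A) m∈ s≤k k≤m with k ≟ pos s
  ... | yes refl = here refl
  ... | no k≢s with m∈
  ...   | here refl  = ⊥-elim (k≢s (ℕₚ.≤-antisym k≤m s≤k))
  ...   | there m∈A  =
    there (ivt-up A m∈A (ℕₚ.≤-trans (proj₂ (edge-step e)) (ℕₚ.≤∧≢⇒< s≤k (λ eq → k≢s (sym eq)))) k≤m)

  lowest highest : ∀ {s t} → Path R n s t → ℕ
  lowest  {s} ξ = min (pos s) (positions ξ)
  highest {s} ξ = max (pos s) (positions ξ)

  lowest-∈ : ∀ {s t} (ξ : Path R n s t) → lowest ξ ∈ positions ξ
  lowest-∈ {s} ξ = [ (λ eq → subst (_∈ positions ξ) (sym eq) (head∈ ξ)) , id ]′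
                     (argmin-sel id (pos s) (positions ξ))

  highest-∈ : ∀ {s t} (ξ : Path R n s t) → highest ξ ∈ positions ξ
  highest-∈ {s} ξ = [ (λ eq → subst (_∈ positions ξ) (sym eq) (head∈ ξ)) , id ]′
                      (argmax-sel id (pos s) (positions ξ))

  excursion-below-corner : ∀ {a b L} (ζ : Path R n (a , L) (b , L)) → 1 ≤ numEdges ζ →
    All (_≤ L) (positions ζ) → IsCorner ζ (L ∸ lowest ζ)
  excursion-below-corner {L = L} ζ nonempty below =
    nonempty , refl , inj₂ (ℕₚ.m∸n≤m L (lowest ζ) , λ k → mk⇔
      (λ k∈ → subst (_≤ k) (sym depth) (All.lookup (min≤xs L (positions ζ)) k∈) , All.lookup below k∈)
      (λ (lo≤k , k≤L) → ivt-down ζ (lowest-∈ ζ) (subst (_≤ k) depth lo≤k) k≤L))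
    where
    depth : L ∸ (L ∸ lowest ζ) ≡ lowest ζ
    depth = ℕₚ.m∸[m∸n]≡n (All.lookup below (lowest-∈ ζ))

  excursion-above-corner : ∀ {a b L} (ζ : Path R n (a , L) (b , L)) → 1 ≤ numEdges ζ →
    All (L ≤_) (positions ζ) → IsCorner ζ (highest ζ ∸ L)
  excursion-above-corner {L = L} ζ nonempty above =
    nonempty , refl , inj₁ (λ k → mk⇔
      (λ k∈ → All.lookup above k∈ , subst (k ≤_) (sym height) (All.lookup (xs≤max L (positions ζ)) k∈))
      (λ (L≤k , k≤hi) → ivt-up ζ (highest-∈ ζ) L≤k (subst (k ≤_) height k≤hi)))
    where
    height : L + (highest ζ ∸ L) ≡ highest ζ
    height = ℕₚ.m+[n∸m]≡n (All.lookup above (highest-∈ ζ))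

  shallow-below : ∀ {a b L} (ζ : Path R n (a , L) (b , L)) → All (_≤ L) (positions ζ) →
    NoLongCornerSubpath ζ → All (InWindow (L ∸ N ℕ.* N) L) (positions ζ)
  shallow-below {L = L} [] (L≤L ∷ []) _ = (ℕₚ.m∸n≤m L (N ℕ.* N) , L≤L) ∷ []
  shallow-below {L = L} ζ@(_ ∷ _) below nl =
    All.zip (All.map (ℕₚ.≤-trans bottom) (min≤xs L (positions ζ)) , below)
    where
    short : L ∸ lowest ζ ≤ N ℕ.* N
    short = ℕₚ.≮⇒≥ (λ long → noLong-whole ζ nl (_ , excursion-below-corner ζ (s≤s z≤n) below , long))
    bottom : L ∸ N ℕ.* N ≤ lowest ζ
    bottom = subst (L ∸ N ℕ.* N ≤_) (ℕₚ.m∸[m∸n]≡n (All.lookup below (lowest-∈ ζ))) (ℕₚ.∸-monoʳ-≤ L short)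

  shallow-above : ∀ {a b L} (ζ : Path R n (a , L) (b , L)) → All (L ≤_) (positions ζ) →
    NoLongCornerSubpath ζ → All (InWindow L (L + N ℕ.* N)) (positions ζ)
  shallow-above {L = L} [] (L≤L ∷ []) _ = (L≤L , ℕₚ.m≤m+n L (N ℕ.* N)) ∷ []
  shallow-above {L = L} ζ@(_ ∷ _) above nl =
    All.zip (above , All.map (λ k≤hi → ℕₚ.≤-trans k≤hi top) (xs≤max L (positions ζ)))
    where
    short : highest ζ ∸ L ≤ N ℕ.* N
    short = ℕₚ.≮⇒≥ (λ long → noLong-whole ζ nl (_ , excursion-above-corner ζ (s≤s z≤n) above , long))
    top : highest ζ ≤ L + N ℕ.* N
    top = subst (_≤ L + N ℕ.* N) (ℕₚ.m+[n∸m]≡n (All.lookup above (highest-∈ ζ))) (ℕₚ.+-monoʳ-≤ L short)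

  data UpCrossing {i p d m} : Path R n (i , p) (d , suc m) → Set where
    crossing : ∀ {c c' ce} (A : Path R n (i , p) (c , m)) → All (_≤ m) (positions A) →
      (m<n : m < n) (mem : atom (inj₁ c) (inj₂ c') ce ∈ R) (C : Path R n (c' , suc m) (d , suc m)) →
      UpCrossing (A ++ₚ (edge m<n mem ∷ C))

  extend-up : ∀ {i p j q d m c₀} (e : Edge R n (i , p) (j , q) c₀) {ξ : Path R n (j , q) (d , suc m)} →
    p ≤ m → UpCrossing ξ → UpCrossing (e ∷ ξ)
  extend-up e p≤m (crossing A below m<n mem C) = crossing (e ∷ A) (p≤m ∷ below) m<n mem C

  up-crossing : ∀ {i p d m} (ξ : Path R n (i , p) (d , suc m)) → p ≤ m → UpCrossing ξ
  up-crossing []  p≤m = ⊥-elim (ℕₚ.1+n≰n p≤m)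
  up-crossing {m = m} (e@(edge {u = inj₁ _} {v = inj₂ _} {p = p} p<n mem) ∷ ξ) p≤m with p ≟ m
  ... | yes refl = crossing [] (p≤m ∷ []) p<n mem ξ
  ... | no p≢m   = extend-up e p≤m (up-crossing ξ (ℕₚ.≤∧≢⇒< p≤m p≢m))
  up-crossing (e@(edge {u = inj₁ _} {v = inj₁ _} _ _) ∷ ξ) p≤m = extend-up e p≤m (up-crossing ξ p≤m)
  up-crossing (e@(edge {u = inj₂ _} {v = inj₂ _} _ _) ∷ ξ) p≤m = extend-up e p≤m (up-crossing ξ p≤m)
  up-crossing (e@(edge {u = inj₂ _} {v = inj₁ _} _ _) ∷ ξ) p≤m =
    extend-up e p≤m (up-crossing ξ (ℕₚ.≤-trans (ℕₚ.n≤1+n _) p≤m))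

  data DownCrossing {i p d m} : Path R n (i , p) (d , m) → Set where
    crossing : ∀ {c c' ce} (A : Path R n (i , p) (c , suc m)) → All (suc m ≤_) (positions A) →
      (m<n : m < n) (mem : atom (inj₂ c) (inj₁ c') ce ∈ R) (C : Path R n (c' , m) (d , m)) →
      DownCrossing (A ++ₚ (edge m<n mem ∷ C))

  extend-down : ∀ {i p j q d m c₀} (e : Edge R n (i , p) (j , q) c₀) {ξ : Path R n (j , q) (d , m)} →
    suc m ≤ p → DownCrossing ξ → DownCrossing (e ∷ ξ)
  extend-down e m<p (crossing A above m<n mem C) = crossing (e ∷ A) (m<p ∷ above) m<n mem C

  down-crossing : ∀ {i p d m} (ξ : Path R n (i , p) (d , m)) → suc m ≤ p → DownCrossing ξ
  down-crossing []  m<m = ⊥-elim (ℕₚ.1+n≰n m<m)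
  down-crossing {m = m} (e@(edge {u = inj₂ _} {v = inj₁ _} {p = p} p<n mem) ∷ ξ) m<p with p ≟ m
  ... | yes refl = crossing [] (m<p ∷ []) p<n mem ξ
  ... | no p≢m   = extend-down e m<p (down-crossing ξ (ℕₚ.≤∧≢⇒< (ℕₚ.≤-pred m<p) (λ eq → p≢m (sym eq))))
  down-crossing (e@(edge {u = inj₁ _} {v = inj₁ _} _ _) ∷ ξ) m<p = extend-down e m<p (down-crossing ξ m<p)
  down-crossing (e@(edge {u = inj₂ _} {v = inj₂ _} _ _) ∷ ξ) m<p = extend-down e m<p (down-crossing ξ m<p)
  down-crossing (e@(edge {u = inj₁ _} {v = inj₂ _} _ _) ∷ ξ) m<p =
    extend-down e m<p (down-crossing ξ (ℕₚ.m≤n⇒m≤1+n m<p))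

val : ∀ {N} → (ℕ → Val N) → Vtx N → ℤ
val V (a , k) = V k a

val-place : ∀ {N} (V : ℕ → Val N) k (u : Var N) → ev (V k) (V (suc k)) u ≡ val V (place k u)
val-place V k (inj₁ _) = refl
val-place V k (inj₂ _) = refl

module PathBounds {N : ℕ} {R : DBC N} (bal : Balanced R) {n : ℕ} where

  data LocatedAtom (lo hi : ℕ) : Vtx N → Vtx N → ℤ → Set where
    located : ∀ {k u v c} → lo ≤ k → k < hi → atom u v c ∈ R →
      LocatedAtom lo hi (place k u) (place k v) c

  -- Balance lets every edge inside a window of at least two levels be read as
  -- an atom placed inside the window: a horizontal edge on the top (bottom)
  -- level is the primed (unprimed) copy of an atom one level lower (higher).
  unprimed-in-window : ∀ {lo hi a b c k} → lo < hi → lo ≤ k → k ≤ hi →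
    atom (inj₁ a) (inj₁ b) c ∈ R → LocatedAtom lo hi (a , k) (b , k) c
  unprimed-in-window {k = zero} lo<hi lo≤0 _ mem = located lo≤0 (ℕₚ.≤-<-trans z≤n lo<hi) mem
  unprimed-in-window {hi = hi} {a} {b} {c} {suc k} lo<hi lo≤k k<hi mem with suc k <? hi
  ... | yes k+1<hi = located lo≤k k+1<hi mem
  ... | no k+1≮hi  = located (ℕₚ.≤-pred (ℕₚ.<-≤-trans lo<hi (ℕₚ.≮⇒≥ k+1≮hi))) k<hi
                       (Equivalence.to (bal a b c) mem)

  primed-in-window : ∀ {lo hi a b c k} → lo < hi → lo ≤ suc k → suc k ≤ hi →
    atom (inj₂ a) (inj₂ b) c ∈ R → LocatedAtom lo hi (a , suc k) (b , suc k) c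
  primed-in-window {lo} {a = a} {b} {c} {k} lo<hi lo≤k+1 k<hi mem with lo ≤? k
  ... | yes lo≤k = located lo≤k k<hi mem
  ... | no lo≰k  = located lo≤k+1 (ℕₚ.≤-<-trans (ℕₚ.≰⇒> lo≰k) lo<hi) (Equivalence.from (bal a b c) mem)

  edge-in-window : ∀ {lo hi s t c} → lo < hi → Edge R n s t c →
    InWindow lo hi (pos s) → InWindow lo hi (pos t) → LocatedAtom lo hi s t c
  edge-in-window lo<hi (edge {u = inj₁ _} {v = inj₁ _} _ mem) (lo≤k , k≤hi) _ =
    unprimed-in-window lo<hi lo≤k k≤hi mem
  edge-in-window lo<hi (edge {u = inj₂ _} {v = inj₂ _} _ mem) (lo≤k , k≤hi) _ =
    primed-in-window lo<hi lo≤k k≤hi mem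
  edge-in-window lo<hi (edge {u = inj₁ _} {v = inj₂ _} _ mem) (lo≤k , _) (_ , k<hi) = located lo≤k k<hi mem
  edge-in-window lo<hi (edge {u = inj₂ _} {v = inj₁ _} _ mem) (_ , k<hi) (lo≤k , _) = located lo≤k k<hi mem

  atom-bound : ∀ {V lo hi s t c} → IsChain ⟦ R ⟧ V lo hi → LocatedAtom lo hi s t c →
    val V s - val V t ℤ.≤ c
  atom-bound {V} H (located {k} {u} {v} lo≤k k<hi mem) =
    subst₂ (λ p q → p - q ℤ.≤ _) (val-place V k u) (val-place V k v) (All.lookup (H k lo≤k k<hi) mem)

  path-bound : ∀ {V lo hi} → lo < hi → IsChain ⟦ R ⟧ V lo hi → ∀ {s t} (ξ : Path R n s t) →
    All (InWindow lo hi) (positions ξ) → val V s - val V t ℤ.≤ weight ξ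
  path-bound {V} _ _ {s} [] _ = diff-refl (val V s)
  path-bound {V} lo<hi H {s} (_∷_ {t = t} e ξ) (in-s ∷ in-ξ) =
    diff-trans {val V s} {val V t}
      (atom-bound H (edge-in-window lo<hi e in-s (all-head ξ in-ξ))) (path-bound lo<hi H ξ in-ξ)

  above-bound : ∀ {m w w'' a b L} → 0 < m → (pw : Pow ⟦ R ⟧ m w w'') (ζ : Path R n (a , L) (b , L)) →
    All (InWindow L (L + m)) (positions ζ) → w a - w b ℤ.≤ weight ζ
  above-bound {m} {w} {a = a} {b} {L} m>0 pw ζ in-window =
    subst (λ X → X a - X b ℤ.≤ weight ζ) start (path-bound {V = V} (ℕₚ.m<m+n L m>0) chain ζ in-window)
    where
    V : ℕ → Val N
    V k = trace m pw (k ∸ L)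
    chain : IsChain ⟦ R ⟧ V L (L + m)
    chain = chain-offset {T = ⟦ R ⟧} {V = trace m pw} L (trace-chain m pw)
    start : V L ≡ w
    start = trans (cong (trace m pw) (ℕₚ.n∸n≡0 L)) (trace-start m pw)

  below-bound : ∀ {m w w' a b L} → 0 < m → 0 < L → (pw : Pow ⟦ R ⟧ m w w') (ζ : Path R n (a , L) (b , L)) →
    All (InWindow (L ∸ m) L) (positions ζ) → w' a - w' b ℤ.≤ weight ζ
  below-bound {m} {w' = w'} {a} {b} {L} m>0 L>0 pw ζ in-window =
    subst₂ (λ p q → p - q ℤ.≤ weight ζ) (end a) (end b)
      (path-bound {V = V} (∸-decreasing L>0 m>0) chain ζ in-window)
    where
    V : ℕ → Val N
    V k = trace m pw (k + m ∸ L)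
    L≤L∸m+m : L ≤ L ∸ m + m
    L≤L∸m+m = subst (L ≤_) (ℕₚ.+-comm m (L ∸ m)) (ℕₚ.m≤n+m∸n L m)
    chain : IsChain ⟦ R ⟧ V (L ∸ m) L
    chain = chain-translate {T = ⟦ R ⟧} {V = λ k → trace m pw (k ∸ L)} m L≤L∸m+m ℕₚ.≤-refl
              (chain-offset {T = ⟦ R ⟧} {V = trace m pw} L (trace-chain m pw))
    end : ∀ c → V L c ≡ w' c
    end c = trans (cong (λ j → trace m pw j c) (ℕₚ.m+n∸m≡n L m)) (trace-end m pw c)

  -- R_s entails the atom x_c − x'_d ≤ ce + w(ζ) carried by an up-edge at level
  -- m followed by a shallow excursion ζ below level m + 1: R bounds the edge and
  -- the witness of S_bw(x') bounds the excursion.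
  Rs-up-step : ∀ {c c' d ce m} → 0 < N ℕ.* N → atom (inj₁ c) (inj₂ c') ce ∈ R →
    (ζ : Path R n (c' , suc m) (d , suc m)) → All (InWindow (suc m ∸ N ℕ.* N) (suc m)) (positions ζ) →
    ∀ u u' → Rs R u u' → u c - u' d ℤ.≤ ce ℤ.+ weight ζ
  Rs-up-step {c} {c'} K>0 mem ζ in-window u u' (Ru , _ , (_ , pw)) =
    diff-trans {u c} {u' c'} (All.lookup Ru mem) (below-bound K>0 (s≤s z≤n) pw ζ in-window)

  -- Dually for a down-edge at level m followed by a shallow excursion above m,
  -- using the witness of S_fw(x).
  Rs-down-step : ∀ {c c' d ce m} → 0 < N ℕ.* N → atom (inj₂ c) (inj₁ c') ce ∈ R →
    (ζ : Path R n (c' , m) (d , m)) → All (InWindow m (m + N ℕ.* N)) (positions ζ) →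
    ∀ u u' → Rs R u u' → u' c - u d ℤ.≤ ce ℤ.+ weight ζ
  Rs-down-step {c} {c'} K>0 mem ζ in-window u u' (Ru , (_ , pw) , _) =
    diff-trans {u' c} {u c'} (All.lookup Ru mem) (above-bound K>0 pw ζ in-window)

  forward-bound : ∀ {x x'} → 0 < N ℕ.* N → (pw : Pow (Rfw R) n x x') → Sfw R x →
    ∀ {i d} m → m ≤ n → (ξ : Path R n (i , 0) (d , m)) → All (_≤ m) (positions ξ) →
    NoLongCornerSubpath ξ → x i - trace n pw m d ℤ.≤ weight ξ
  forward-bound {x} K>0 pw (_ , spw) {i} {d} zero _ ξ at-0 _ =
    subst (λ X → x i - X d ℤ.≤ weight ξ) (sym (trace-start n pw))
      (above-bound K>0 spw ξ (All.map (λ k≤0 → z≤n , ℕₚ.≤-trans k≤0 z≤n) at-0))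
  forward-bound {x} K>0 pw sx {i} {d} (suc m) m<n ξ below nl with up-crossing ξ z≤n
  ... | crossing {c} {ce = ce} A below-m _ mem C =
    subst (x i - y (suc m) d ℤ.≤_) (sym (weight-++ A _)) (diff-trans {x i} {y m c} prefix crossing-step)
    where
    y : ℕ → Val N
    y = trace n pw
    nl-C : NoLongCornerSubpath C
    nl-C = noLong-suffix (edge _ mem ∷ []) C (noLong-suffix A _ nl)
    below-C : All (_≤ suc m) (positions C)
    below-C = All.tail (all-suffix A _ below)
    prefix : x i - y m c ℤ.≤ weight A
    prefix = forward-bound K>0 pw sx m (ℕₚ.<⇒≤ m<n) A below-m (noLong-prefix A _ nl)
    crossing-step : y m c - y (suc m) d ℤ.≤ ce ℤ.+ weight C
    crossing-step = trace-chain n pw m z≤n m<n c d _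
                      (Rs-up-step K>0 mem C (shallow-below C below-C nl-C))

  backward-bound : ∀ {x x'} → 0 < N ℕ.* N → 0 < n → (pw : Pow (Rbw R) n x x') → Sbw R x' →
    ∀ {i d} k m → k + m ≡ n → (ξ : Path R n (i , n) (d , m)) → All (m ≤_) (positions ξ) →
    NoLongCornerSubpath ξ → x' i - trace n pw m d ℤ.≤ weight ξ
  backward-bound {x' = x'} K>0 n>0 pw (_ , spw) {i} {d} zero _ refl ξ _ nl =
    subst (λ v → x' i - v ℤ.≤ weight ξ) (sym (trace-end n pw d))
      (below-bound K>0 n>0 spw ξ (shallow-below ξ (positions≤n ξ ℕₚ.≤-refl) nl))
  backward-bound {x' = x'} K>0 n>0 pw sx' {i} {d} (suc k) m k+m≡n ξ above nl
    with down-crossing ξ (level-below k+m≡n)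
  ... | crossing {c} {ce = ce} A above-m _ mem C =
    subst (x' i - z m d ℤ.≤_) (sym (weight-++ A _)) (diff-trans {x' i} {z (suc m) c} prefix crossing-step)
    where
    z : ℕ → Val N
    z = trace n pw
    nl-C : NoLongCornerSubpath C
    nl-C = noLong-suffix (edge _ mem ∷ []) C (noLong-suffix A _ nl)
    above-C : All (m ≤_) (positions C)
    above-C = All.tail (all-suffix A _ above)
    prefix : x' i - z (suc m) c ℤ.≤ weight A
    prefix = backward-bound K>0 n>0 pw sx' k (suc m) (trans (ℕₚ.+-suc k m) k+m≡n) A above-m
               (noLong-prefix A _ nl)
    crossing-step : z (suc m) c - z m d ℤ.≤ ce ℤ.+ weight C
    crossing-step = trace-chain n pw m z≤n (level-below k+m≡n) c d _
                      (Rs-down-step K>0 mem C (shallow-above C above-C nl-C))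

  module Cases {R̂fw R̂bw : ℕ → Rel N} (n>0 : 0 < n) (K>0 : 0 < N ℕ.* N) {i j p q}
           (ξ : Path R n (i , p) (j , q)) (nl : NoLongCornerSubpath ξ) where

    bound-0→n : IsClosedForm (Rfw R) R̂fw → p ≡ 0 → q ≡ n →
      ∀ x x' → φ R R̂fw R̂bw n x x' → x i - x' j ℤ.≤ weight ξ
    bound-0→n cf refl refl x x' (f̂ , _ , sx , _) =
      subst (λ v → x i - v ℤ.≤ weight ξ) (trace-end n pw j)
        (forward-bound K>0 pw sx n ℕₚ.≤-refl ξ (positions≤n ξ z≤n) nl)
      where
      pw : Pow (Rfw R) n x x'
      pw = Equivalence.to (cf n n>0 x x') f̂

    bound-n→0 : IsClosedForm (Rbw R) R̂bw → p ≡ n → q ≡ 0 →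
      ∀ x x' → φ R R̂fw R̂bw n x x' → x' i - x j ℤ.≤ weight ξ
    bound-n→0 cb refl refl x x' (_ , b̂ , _ , sx') =
      subst (λ v → x' i - v j ℤ.≤ weight ξ) (trace-start n pw)
        (backward-bound K>0 n>0 pw sx' n 0 (ℕₚ.+-identityʳ n) ξ (All.tabulate (λ _ → z≤n)) nl)
      where
      pw : Pow (Rbw R) n x x'
      pw = Equivalence.to (cb n n>0 x x') b̂

    bound-0→0 : p ≡ 0 → q ≡ 0 → ∀ x x' → φ R R̂fw R̂bw n x x' → x i - x j ℤ.≤ weight ξ
    bound-0→0 refl refl x x' (_ , _ , (_ , spw) , _) =
      above-bound K>0 spw ξ (shallow-above ξ (All.tabulate (λ _ → z≤n)) nl)

    bound-n→n : p ≡ n → q ≡ n → ∀ x x' → φ R R̂fw R̂bw n x x' → x' i - x' j ℤ.≤ weight ξ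
    bound-n→n refl refl x x' (_ , _ , _ , (_ , spw)) =
      below-bound K>0 n>0 spw ξ (shallow-below ξ (positions≤n ξ ℕₚ.≤-refl) nl)

square-positive : ∀ {N} → Fin N → 0 < N ℕ.* N
square-positive {suc N} _ = s≤s z≤n

proposition6 : (N : ℕ) (R : DBC N) → Balanced R → (n : ℕ) → 1 ≤ n →
    (R̂fw R̂bw : ℕ → Rel N) → IsClosedForm (Rfw R) R̂fw → IsClosedForm (Rbw R) R̂bw →
    (i j : Fin N) (p q : ℕ) (ξ : Path R n (i , p) (j , q)) → NoLongCornerSubpath ξ →
    (p ≡ 0 → q ≡ n → ∀ x x' → φ R R̂fw R̂bw n x x' → (x i - x' j) ℤ.≤ weight ξ)
    × (p ≡ n → q ≡ 0 → ∀ x x' → φ R R̂fw R̂bw n x x' → (x' i - x j) ℤ.≤ weight ξ)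
    × (p ≡ 0 → q ≡ 0 → ∀ x x' → φ R R̂fw R̂bw n x x' → (x i - x j) ℤ.≤ weight ξ)
    × (p ≡ n → q ≡ n → ∀ x x' → φ R R̂fw R̂bw n x x' → (x' i - x' j) ℤ.≤ weight ξ)
proposition6 N R bal n n≥1 R̂fw R̂bw cf cb i j p q ξ nl =
  bound-0→n cf , bound-n→0 cb , bound-0→0 , bound-n→n
  where
  open PathBounds bal {n}
  open Cases {R̂fw} {R̂bw} n≥1 (square-positive i) ξ nl
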